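{- Let $d\ge0$ and $m=2^d$. For each integer $k$ with $1\le k\le m$, the number of distinct $(k,m)$-affine necklaces (as words) is exactly $2^{k+m-1}$.
   Context: Words are over $\mathbb{F}_2=\{0,1\}$; a word $a_1\cdots a_n$ is identified with the column vector $(a_1,\dots,a_n)^t$, and $\oplus$ is componentwise addition mod $2$. Matrices: $M_0=(1)$, $M_{d+1}=\begin{pmatrix}M_d&M_d\\0&M_d\end{pmatrix}$ over $\mathbb{F}_2$. Let $\sigma$ map $a_1\cdots a_n$ to $a_na_1\cdots a_{n-1}$ (also on column vectors). For integers $n_1,\dots,n_m$ with $n_m=0$ and $n_{i+1}\le n_i\le n_{i+1}+1$ ($1\le i<m$), and $C_1,\dots,C_m$ the columns of $M_d$, set $M_d^{n_1,\dots,n_m}=(\sigma^{n_1}(C_1),\dots,\sigma^{n_m}(C_m))$. Let $w_1,\dots,w_{2^m}$ be all binary words of length $m$ in lexicographic order. A $(k,m)$-affine necklace is a word $(Mw'_1)(Mw'_2)\cdots(Mw'_{2^k})$ (concatenation) where $M$ is some $M_d^{n_1,\dots,n_m}$, $z$ is a binary word of length $m$, and $w'_i=w_i\oplus z$. -}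

module Defs where

open import Data.Bool using (Bool; true; false; _xor_; if_then_else_)
open import Data.Nat using (ℕ; zero; suc; _+_; _*_; _^_; _≤_)
open import Data.Nat.Properties using (+-identityʳ)
open import Data.Fin as Fin using (Fin)
open import Data.Sum using (inj₁; inj₂)
open import Data.Vec as Vec using (Vec; []; _∷_)
open import Data.List as List using (List)
open import Data.Product using (Σ; _×_; _,_)
open import Data.Unit using (⊤)
open import Relation.Binary.PropositionalEquality using (_≡_; cong)
open import Function using (_∘_)

double : (d : ℕ) → 2 ^ suc d ≡ 2 ^ d + 2 ^ d
double d = cong (2 ^ d +_) (+-identityʳ (2 ^ d))

-- The matrix M_d over F_2, entries M d i j (row i, column j, 0-indexed):
-- M_0 = (1),  M_{d+1} = [[M_d, M_d],[0, M_d]].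
M : (d : ℕ) → Fin (2 ^ d) → Fin (2 ^ d) → Bool
M zero    i j = true
M (suc d) i j with Fin.splitAt (2 ^ d) (Fin.cast (double d) i)
                 | Fin.splitAt (2 ^ d) (Fin.cast (double d) j)
... | inj₁ i' | inj₁ j' = M d i' j'
... | inj₁ i' | inj₂ j' = M d i' j'
... | inj₂ i' | inj₁ j' = false
... | inj₂ i' | inj₂ j' = M d i' j'

column : (d : ℕ) → Fin (2 ^ d) → Vec Bool (2 ^ d)
column d j = Vec.tabulate (λ i → M d i j)

σ : {n : ℕ} → Vec Bool n → Vec Bool n
σ {zero}  xs = xs
σ {suc n} xs = Vec.last xs ∷ Vec.init xs

σ^ : {n : ℕ} → ℕ → Vec Bool n → Vec Bool n
σ^ zero    xs = xs
σ^ (suc k) xs = σ (σ^ k xs)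

Admissible : {m : ℕ} → Vec ℕ m → Set
Admissible [] = ⊤
Admissible (x ∷ []) = x ≡ 0
Admissible (x ∷ y ∷ ys) = (y ≤ x) × (x ≤ suc y) × Admissible (y ∷ ys)

-- M_d^{n_1,…,n_m}, given by its list of columns σ^{n_j}(C_j)
Mcols : (d : ℕ) → Vec ℕ (2 ^ d) → Vec (Vec Bool (2 ^ d)) (2 ^ d)
Mcols d ns = Vec.tabulate (λ j → σ^ (Vec.lookup ns j) (column d j))

_⊕_ : {n : ℕ} → Vec Bool n → Vec Bool n → Vec Bool n
_⊕_ = Vec.zipWith _xor_

zeros : {n : ℕ} → Vec Bool n
zeros = Vec.replicate _ false

_·_ : {n k : ℕ} → Vec (Vec Bool n) k → Vec Bool k → Vec Bool n
cols · w = Vec.foldr _ _⊕_ zeros (Vec.zipWith (λ c b → if b then c else zeros) cols w)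

lexWords : (m : ℕ) → List (Vec Bool m)
lexWords zero    = List.[ [] ]
lexWords (suc m) = List.map (false ∷_) (lexWords m) List.++ List.map (true ∷_) (lexWords m)

necklace : (d k : ℕ) → Vec ℕ (2 ^ d) → Vec Bool (2 ^ d) → List Bool
necklace d k ns z =
  List.concatMap (λ w → Vec.toList (Mcols d ns · (w ⊕ z))) (List.take (2 ^ k) (lexWords (2 ^ d)))

IsAffineNecklace : (d k : ℕ) → List Bool → Set
IsAffineNecklace d k w =
  Σ (Vec ℕ (2 ^ d)) λ ns → Admissible ns × Σ (Vec Bool (2 ^ d)) λ z → necklace d k ns z ≡ w

{-# OPTIONS --safe #-}
module Submission where

-- Write D = 1 + σ. By Pascal's rule mod 2, D maps column t of M_d to column t + 1, and the last
-- column is all ones; as D commutes with σ, D^(m−1−t) maps σ^(n_t)(C_t) to all ones. So the columns of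
-- M = M_d^(n_1,…,n_m) are triangular with respect to the powers of D, which makes M invertible.
-- The first 2^k words in lexicographic order are the words supported on the last k positions, so the
-- necklace determines and is determined by M z and the last k columns of M. Column t is
-- σ^(n_t)(C_t), whose first 1 sits at position n_t, so these columns determine the last k exponents:
-- an admissible tail, i.e. k − 1 free descent bits. As M z ranges over all 2^m words, there are
-- 2^(k−1) · 2^m necklaces.

open import Defs
open import Data.Bool using (Bool; true; false; _xor_; if_then_else_)
open import Data.Bool.Properties using (xor-assoc; xor-comm; xor-same; xor-identityˡ; xor-identityʳ)
open import Data.Nat using (ℕ; zero; suc; _+_; _*_; _^_; _∸_; _⊓_; _≤_; _<_; z≤n; s≤s; z<s; s≤s⁻¹; s<s⁻¹; _<?_; _≤?_; _≟_)
open import Data.Nat.Properties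
open import Data.Fin as Fin using (Fin; toℕ; fromℕ; inject₁)
import Data.Fin.Properties as Finₚ
open import Data.Vec as Vec using (Vec; []; _∷_; lookup; tabulate; replicate)
open import Data.Vec.Properties
  using (lookup-zipWith; zipWith-assoc; zipWith-comm; zipWith-identityˡ; zipWith-identityʳ;
         tabulate∘lookup; tabulate-cong; lookup∘tabulate; lookup-replicate; ∷-injectiveˡ; ∷-injectiveʳ;
         toList-injective; length-toList; cast-is-id)
open import Data.Sum using (inj₁; inj₂)
open import Data.Empty using (⊥)
open import Data.List as List using (List; _∷_; []; length; map; take; _++_; concatMap; cartesianProduct)
import Data.List.Properties as Listₚ
open import Data.List.Membership.Propositional using (_∈_)
open import Data.List.Membership.Propositional.Properties
  using (∈-map⁺; ∈-map⁻; ∈-++⁺ˡ; ∈-++⁺ʳ; ∈-cartesianProduct⁺; ∈-cartesianProduct⁻)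
open import Data.List.Relation.Unary.Any using (here; there)
import Data.List.Relation.Unary.AllPairs as AllPairs
open import Data.List.Relation.Unary.All as All using (All)
import Data.List.Relation.Unary.All.Properties as Allₚ
open import Data.List.Relation.Unary.Unique.Propositional using (Unique)
import Data.List.Relation.Unary.Unique.Propositional.Properties as Uniqueₚ
open import Data.Product using (Σ; _×_; _,_; proj₁; proj₂; map₁)
open import Relation.Nullary using (yes; no; ¬_)
open import Function.Bundles using (_⇔_; mk⇔)
open import Relation.Nullary.Negation using (contradiction)
open import Relation.Binary.PropositionalEquality
open import Relation.Binary.Definitions using (tri<; tri≈; tri>)
open import Function using (_∘_)

private variable
  n L : ℕ

-- Binary vectors, the rotation σ and the difference operator D

lookup-ext : {A : Set} (u v : Vec A n) → (∀ i → lookup u i ≡ lookup v i) → u ≡ v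
lookup-ext u v eq = begin
  u                  ≡⟨ tabulate∘lookup u ⟨
  tabulate (lookup u) ≡⟨ tabulate-cong eq ⟩
  tabulate (lookup v) ≡⟨ tabulate∘lookup v ⟩
  v                  ∎
  where open ≡-Reasoning

ones : Vec Bool n
ones = replicate _ true

lookup-⊕ : (u v : Vec Bool n) (i : Fin n) → lookup (u ⊕ v) i ≡ lookup u i xor lookup v i
lookup-⊕ u v i = lookup-zipWith _xor_ i u v

⊕-assoc : (u v w : Vec Bool n) → (u ⊕ v) ⊕ w ≡ u ⊕ (v ⊕ w)
⊕-assoc = zipWith-assoc xor-assoc

⊕-comm : (u v : Vec Bool n) → u ⊕ v ≡ v ⊕ u
⊕-comm = zipWith-comm xor-comm

⊕-identityˡ : (u : Vec Bool n) → zeros ⊕ u ≡ u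
⊕-identityˡ = zipWith-identityˡ xor-identityˡ

⊕-identityʳ : (u : Vec Bool n) → u ⊕ zeros ≡ u
⊕-identityʳ = zipWith-identityʳ xor-identityʳ

⊕-self : (u : Vec Bool n) → u ⊕ u ≡ zeros
⊕-self []      = refl
⊕-self (x ∷ u) = cong₂ _∷_ (xor-same x) (⊕-self u)

u⊕[u⊕v]≡v : (u v : Vec Bool n) → u ⊕ (u ⊕ v) ≡ v
u⊕[u⊕v]≡v u v = begin
  u ⊕ (u ⊕ v) ≡⟨ ⊕-assoc u u v ⟨
  (u ⊕ u) ⊕ v ≡⟨ cong (_⊕ v) (⊕-self u) ⟩
  zeros ⊕ v   ≡⟨ ⊕-identityˡ v ⟩
  v           ∎
  where open ≡-Reasoning

⊕-cancelˡ : (u v w : Vec Bool n) → u ⊕ v ≡ u ⊕ w → v ≡ w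
⊕-cancelˡ u v w eq = begin
  v           ≡⟨ u⊕[u⊕v]≡v u v ⟨
  u ⊕ (u ⊕ v) ≡⟨ cong (u ⊕_) eq ⟩
  u ⊕ (u ⊕ w) ≡⟨ u⊕[u⊕v]≡v u w ⟩
  w           ∎
  where open ≡-Reasoning

u⊕v≡zeros⇒u≡v : (u v : Vec Bool n) → u ⊕ v ≡ zeros → u ≡ v
u⊕v≡zeros⇒u≡v u v eq = ⊕-cancelˡ v u v (trans (⊕-comm v u) (trans eq (sym (⊕-self v))))

⊕-interchange : (u v w x : Vec Bool n) → (u ⊕ v) ⊕ (w ⊕ x) ≡ (u ⊕ w) ⊕ (v ⊕ x)
⊕-interchange u v w x = begin
  (u ⊕ v) ⊕ (w ⊕ x) ≡⟨ ⊕-assoc u v (w ⊕ x) ⟩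
  u ⊕ (v ⊕ (w ⊕ x)) ≡⟨ cong (u ⊕_) (⊕-assoc v w x) ⟨
  u ⊕ ((v ⊕ w) ⊕ x) ≡⟨ cong (λ y → u ⊕ (y ⊕ x)) (⊕-comm v w) ⟩
  u ⊕ ((w ⊕ v) ⊕ x) ≡⟨ cong (u ⊕_) (⊕-assoc w v x) ⟩
  u ⊕ (w ⊕ (v ⊕ x)) ≡⟨ ⊕-assoc u w (v ⊕ x) ⟨
  (u ⊕ w) ⊕ (v ⊕ x) ∎
  where open ≡-Reasoning

cyclicPred : Fin n → Fin n
cyclicPred {suc n} Fin.zero    = fromℕ n
cyclicPred {suc n} (Fin.suc i) = inject₁ i

lookup-σ : (v : Vec Bool n) (i : Fin n) → lookup (σ v) i ≡ lookup v (cyclicPred i)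
lookup-σ {suc n} v Fin.zero    = last≡lookup-fromℕ v
  where
  last≡lookup-fromℕ : ∀ {n} (v : Vec Bool (suc n)) → Vec.last v ≡ lookup v (fromℕ n)
  last≡lookup-fromℕ (x ∷ [])     = refl
  last≡lookup-fromℕ (x ∷ y ∷ v) = last≡lookup-fromℕ (y ∷ v)
lookup-σ {suc n} v (Fin.suc i) = lookup-init v i
  where
  lookup-init : ∀ {n} (v : Vec Bool (suc n)) (i : Fin n) → lookup (Vec.init v) i ≡ lookup v (inject₁ i)
  lookup-init (x ∷ y ∷ v) Fin.zero    = refl
  lookup-init (x ∷ y ∷ v) (Fin.suc i) = lookup-init (y ∷ v) i

σ-⊕ : (u v : Vec Bool n) → σ (u ⊕ v) ≡ σ u ⊕ σ v
σ-⊕ u v = lookup-ext _ _ λ i → begin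
  lookup (σ (u ⊕ v)) i                               ≡⟨ lookup-σ (u ⊕ v) i ⟩
  lookup (u ⊕ v) (cyclicPred i)                      ≡⟨ lookup-⊕ u v (cyclicPred i) ⟩
  lookup u (cyclicPred i) xor lookup v (cyclicPred i) ≡⟨ cong₂ _xor_ (lookup-σ u i) (lookup-σ v i) ⟨
  lookup (σ u) i xor lookup (σ v) i                  ≡⟨ lookup-⊕ (σ u) (σ v) i ⟨
  lookup (σ u ⊕ σ v) i                               ∎
  where open ≡-Reasoning

σ-replicate : (b : Bool) → σ (replicate n b) ≡ replicate n b
σ-replicate b = lookup-ext _ _ λ i →
  trans (lookup-σ _ i) (trans (lookup-replicate (cyclicPred i) b) (sym (lookup-replicate i b)))

σ^-replicate : ∀ a (b : Bool) → σ^ a (replicate n b) ≡ replicate n b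
σ^-replicate zero    b = refl
σ^-replicate (suc a) b = trans (cong σ (σ^-replicate a b)) (σ-replicate b)

σ-fixed⇒constant : (v : Vec Bool n) → σ v ≡ v → Σ Bool λ b → v ≡ replicate n b
σ-fixed⇒constant []      _  = false , refl
σ-fixed⇒constant (x ∷ u) eq = x , cong (x ∷_) (init≡⇒constant x u (∷-injectiveʳ eq))
  where
  init≡⇒constant : ∀ {n} x (u : Vec Bool n) → Vec.init (x ∷ u) ≡ u → u ≡ replicate n x
  init≡⇒constant x []      _  = refl
  init≡⇒constant x (y ∷ u) eq with refl ← ∷-injectiveˡ eq = cong (x ∷_) (init≡⇒constant x u (∷-injectiveʳ eq))

D : Vec Bool n → Vec Bool n
D v = v ⊕ σ v

D^ : ℕ → Vec Bool n → Vec Bool n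
D^ zero    v = v
D^ (suc r) v = D (D^ r v)

D-⊕ : (u v : Vec Bool n) → D (u ⊕ v) ≡ D u ⊕ D v
D-⊕ u v = trans (cong ((u ⊕ v) ⊕_) (σ-⊕ u v)) (⊕-interchange u v (σ u) (σ v))

D^-⊕ : ∀ r (u v : Vec Bool n) → D^ r (u ⊕ v) ≡ D^ r u ⊕ D^ r v
D^-⊕ zero    u v = refl
D^-⊕ (suc r) u v = trans (cong D (D^-⊕ r u v)) (D-⊕ (D^ r u) (D^ r v))

D-replicate : (b : Bool) → D (replicate n b) ≡ zeros
D-replicate b = trans (cong (replicate _ b ⊕_) (σ-replicate b)) (⊕-self (replicate _ b))

D^-zeros : ∀ r → D^ r (zeros {n}) ≡ zeros
D^-zeros zero    = refl
D^-zeros (suc r) = trans (cong D (D^-zeros r)) (D-replicate false)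

D^-+ : ∀ r s (v : Vec Bool n) → D^ (r + s) v ≡ D^ r (D^ s v)
D^-+ zero    s v = refl
D^-+ (suc r) s v = cong D (D^-+ r s v)

D^-σ^ : ∀ r a (v : Vec Bool n) → D^ r (σ^ a v) ≡ σ^ a (D^ r v)
D^-σ^ zero    a v = refl
D^-σ^ (suc r) a v = trans (cong D (D^-σ^ r a v)) (sym (σ^-D a (D^ r v)))
  where
  σ^-D : ∀ a (v : Vec Bool n) → σ^ a (D v) ≡ D (σ^ a v)
  σ^-D zero    v = refl
  σ^-D (suc a) v = trans (cong σ (σ^-D a v)) (σ-⊕ (σ^ a v) (σ (σ^ a v)))

D^-ones-then-zeros : ∀ r s (v : Vec Bool n) → D^ r v ≡ ones → D^ (s + suc r) v ≡ zeros
D^-ones-then-zeros r s v eq = begin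
  D^ (s + suc r) v    ≡⟨ D^-+ s (suc r) v ⟩
  D^ s (D (D^ r v))   ≡⟨ cong (λ w → D^ s (D w)) eq ⟩
  D^ s (D ones)       ≡⟨ cong (D^ s) (D-replicate true) ⟩
  D^ s zeros          ≡⟨ D^-zeros s ⟩
  zeros               ∎
  where open ≡-Reasoning

D-kernel : (v : Vec Bool n) → D v ≡ zeros → Σ Bool λ b → v ≡ replicate n b
D-kernel v eq = σ-fixed⇒constant v (sym (u⊕v≡zeros⇒u≡v v (σ v) eq))

select : Bool → Vec Bool n → Vec Bool n
select b c = if b then c else zeros

select-replicate : ∀ b → select b (ones {n}) ≡ replicate n b
select-replicate false = refl
select-replicate true  = refl

D^-select : ∀ r b (c : Vec Bool n) → D^ r (select b c) ≡ select b (D^ r c)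
D^-select r false c = D^-zeros r
D^-select r true  c = refl

·-⊕ : ∀ (cs : Vec (Vec Bool n) L) (u v : Vec Bool L) → cs · (u ⊕ v) ≡ (cs · u) ⊕ (cs · v)
·-⊕ []       []      []      = sym (⊕-self zeros)
·-⊕ (c ∷ cs) (x ∷ u) (y ∷ v) = begin
  select (x xor y) c ⊕ (cs · (u ⊕ v))                  ≡⟨ cong₂ _⊕_ (select-xor x y) (·-⊕ cs u v) ⟩
  (select x c ⊕ select y c) ⊕ ((cs · u) ⊕ (cs · v))   ≡⟨ ⊕-interchange (select x c) (select y c) (cs · u) (cs · v) ⟩
  (select x c ⊕ (cs · u)) ⊕ (select y c ⊕ (cs · v))   ∎
  where
  open ≡-Reasoning
  select-xor : ∀ x y → select (x xor y) c ≡ select x c ⊕ select y c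
  select-xor false y     = sym (⊕-identityˡ _)
  select-xor true  false = sym (⊕-identityʳ c)
  select-xor true  true  = sym (⊕-self c)

·-zeros : (cs : Vec (Vec Bool n) L) → cs · zeros ≡ zeros
·-zeros []       = refl
·-zeros (c ∷ cs) = trans (⊕-identityˡ _) (·-zeros cs)

D^-· : ∀ r (cs : Vec (Vec Bool n) L) w → (∀ i → D^ r (lookup cs i) ≡ zeros) → D^ r (cs · w) ≡ zeros
D^-· r []       []      _    = D^-zeros r
D^-· r (c ∷ cs) (b ∷ w) kill = begin
  D^ r (select b c ⊕ (cs · w))              ≡⟨ D^-⊕ r (select b c) (cs · w) ⟩
  D^ r (select b c) ⊕ D^ r (cs · w)         ≡⟨ cong₂ _⊕_ (D^-select r b c) (D^-· r cs w (kill ∘ Fin.suc)) ⟩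
  select b (D^ r c) ⊕ zeros                 ≡⟨ cong (λ x → select b x ⊕ zeros) (kill Fin.zero) ⟩
  select b zeros ⊕ zeros                    ≡⟨ cong (_⊕ zeros) (select-zeros b) ⟩
  zeros ⊕ zeros                             ≡⟨ ⊕-self zeros ⟩
  zeros                                     ∎
  where
  open ≡-Reasoning
  select-zeros : ∀ b → select b (zeros {n}) ≡ zeros
  select-zeros false = refl
  select-zeros true  = refl

-- Column lists that are triangular with respect to D

-- Column i lies in ker D^(L−i) but not in ker D^(L−1−i): a staircase for ker D ⊆ ker D² ⊆ ⋯.
DTriangular : Vec (Vec Bool n) L → Set
DTriangular {L = L} cs = ∀ i → D^ (L ∸ suc (toℕ i)) (lookup cs i) ≡ ones

D^-kills-image : (cs : Vec (Vec Bool n) L) → DTriangular cs → ∀ z → D^ L (cs · z) ≡ zeros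
D^-kills-image {L = L} cs tri z = D^-· L cs z kills-column
  where
  kills-column : ∀ i → D^ L (lookup cs i) ≡ zeros
  kills-column i = subst (λ r → D^ r (lookup cs i) ≡ zeros) split
                         (D^-ones-then-zeros _ (toℕ i) (lookup cs i) (tri i))
    where
    split : toℕ i + suc (L ∸ suc (toℕ i)) ≡ L
    split = trans (+-suc (toℕ i) _) (m+[n∸m]≡n (Finₚ.toℕ<n i))

triangular-kernel : ¬ (ones {n} ≡ zeros) → (cs : Vec (Vec Bool n) L) → DTriangular cs →
                    ∀ z → cs · z ≡ zeros → z ≡ zeros
triangular-kernel ones≢zeros []       _   []           _  = refl
triangular-kernel ones≢zeros (c ∷ cs) tri (false ∷ z) eq =
  cong (false ∷_) (triangular-kernel ones≢zeros cs (tri ∘ Fin.suc) z (trans (sym (⊕-identityˡ _)) eq))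
triangular-kernel {L = suc L} ones≢zeros (c ∷ cs) tri (true ∷ z) eq = contradiction (begin
  ones                         ≡⟨ ⊕-identityʳ ones ⟨
  ones ⊕ zeros                 ≡⟨ cong₂ _⊕_ (tri Fin.zero) (D^-kills-image cs (tri ∘ Fin.suc) z) ⟨
  D^ L c ⊕ D^ L (cs · z)       ≡⟨ D^-⊕ L c (cs · z) ⟨
  D^ L (c ⊕ (cs · z))          ≡⟨ cong (D^ L) eq ⟩
  D^ L zeros                   ≡⟨ D^-zeros L ⟩
  zeros                        ∎) ones≢zeros
  where open ≡-Reasoning

triangular-injective : ¬ (ones {n} ≡ zeros) → (cs : Vec (Vec Bool n) L) → DTriangular cs →
                       ∀ u v → cs · u ≡ cs · v → u ≡ v
triangular-injective ones≢zeros cs tri u v eq =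
  u⊕v≡zeros⇒u≡v u v (triangular-kernel ones≢zeros cs tri (u ⊕ v) (begin
    cs · (u ⊕ v)         ≡⟨ ·-⊕ cs u v ⟩
    (cs · u) ⊕ (cs · v)  ≡⟨ cong (_⊕ (cs · v)) eq ⟩
    (cs · v) ⊕ (cs · v)  ≡⟨ ⊕-self (cs · v) ⟩
    zeros                ∎))
  where open ≡-Reasoning

-- Back substitution: the coefficient of the first column is read off from D^L y, which is constant.
triangular-image : (cs : Vec (Vec Bool n) L) → DTriangular cs →
                   ∀ y → D^ L y ≡ zeros → Σ (Vec Bool L) λ z → cs · z ≡ y
triangular-image []       _   y eq = [] , sym eq
triangular-image {n = n} {L = suc L} (c ∷ cs) tri y eq =
  let b , D^Ly≡b = D-kernel (D^ L y) eq
      z , cs·z≡ = triangular-image cs (tri ∘ Fin.suc) (select b c ⊕ y) (residual b D^Ly≡b)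
  in b ∷ z , trans (cong (select b c ⊕_) cs·z≡) (u⊕[u⊕v]≡v (select b c) y)
  where
  open ≡-Reasoning
  residual : ∀ b → D^ L y ≡ replicate n b → D^ L (select b c ⊕ y) ≡ zeros
  residual b D^Ly≡b = begin
    D^ L (select b c ⊕ y)           ≡⟨ D^-⊕ L (select b c) y ⟩
    D^ L (select b c) ⊕ D^ L y      ≡⟨ cong₂ _⊕_ (D^-select L b c) D^Ly≡b ⟩
    select b (D^ L c) ⊕ replicate n b ≡⟨ cong (λ x → select b x ⊕ replicate n b) (tri Fin.zero) ⟩
    select b ones ⊕ replicate n b   ≡⟨ cong (_⊕ replicate n b) (select-replicate b) ⟩
    replicate n b ⊕ replicate n b   ≡⟨ ⊕-self (replicate n b) ⟩
    zeros                           ∎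

-- The matrix M_d and Pascal's rule

-- M_d with natural-number indices, free of the casts in M (see M≡Mℕ); Pascal's rule is stated on it.
Mℕ : ℕ → ℕ → ℕ → Bool
Mℕ zero    i j = true
Mℕ (suc d) i j with i <? 2 ^ d | j <? 2 ^ d
... | yes _ | yes _ = Mℕ d i j
... | yes _ | no  _ = Mℕ d i (j ∸ 2 ^ d)
... | no  _ | yes _ = false
... | no  _ | no  _ = Mℕ d (i ∸ 2 ^ d) (j ∸ 2 ^ d)

module _ (d : ℕ) {x y : ℕ} where

  Mℕ-upperLeft : x < 2 ^ d → y < 2 ^ d → Mℕ (suc d) x y ≡ Mℕ d x y
  Mℕ-upperLeft x<h y<h with x <? 2 ^ d | y <? 2 ^ d
  ... | yes _  | yes _  = refl
  ... | no x≮h | _      = contradiction x<h x≮h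
  ... | yes _  | no y≮h = contradiction y<h y≮h

  Mℕ-upperRight : x < 2 ^ d → Mℕ (suc d) x (2 ^ d + y) ≡ Mℕ d x y
  Mℕ-upperRight x<h with x <? 2 ^ d | 2 ^ d + y <? 2 ^ d
  ... | yes _  | no _       = cong (Mℕ d x) (m+n∸m≡n (2 ^ d) y)
  ... | no x≮h | _          = contradiction x<h x≮h
  ... | yes _  | yes h+y<h  = contradiction h+y<h (m+n≮m (2 ^ d) y)

  Mℕ-lowerLeft : y < 2 ^ d → Mℕ (suc d) (2 ^ d + x) y ≡ false
  Mℕ-lowerLeft y<h with 2 ^ d + x <? 2 ^ d | y <? 2 ^ d
  ... | no _      | yes _  = refl
  ... | yes h+x<h | _      = contradiction h+x<h (m+n≮m (2 ^ d) x)
  ... | no _      | no y≮h = contradiction y<h y≮h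

  Mℕ-lowerRight : Mℕ (suc d) (2 ^ d + x) (2 ^ d + y) ≡ Mℕ d x y
  Mℕ-lowerRight with 2 ^ d + x <? 2 ^ d | 2 ^ d + y <? 2 ^ d
  ... | no _      | no _      = cong₂ (Mℕ d) (m+n∸m≡n (2 ^ d) x) (m+n∸m≡n (2 ^ d) y)
  ... | yes h+x<h | _         = contradiction h+x<h (m+n≮m (2 ^ d) x)
  ... | no _      | yes h+y<h = contradiction h+y<h (m+n≮m (2 ^ d) y)

data Half (h : ℕ) : ℕ → Set where
  low  : ∀ {x} → x < h → Half h x
  high : ∀ {x} → x < h → Half h (h + x)

half : ∀ d {x} → x < 2 ^ suc d → Half (2 ^ d) x
half d {x} x<2h with x <? 2 ^ d
... | yes x<h = low x<h
... | no x≮h with m≤n⇒∃[o]m+o≡n (≮⇒≥ x≮h)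
...   | o , refl = high (+-cancelˡ-< (2 ^ d) o (2 ^ d) (subst (2 ^ d + o <_) (double d) x<2h))

toℕ-lowHalf : ∀ {d} (i : Fin (2 ^ suc d)) {i′} → Fin.splitAt (2 ^ d) (Fin.cast (double d) i) ≡ inj₁ i′ → toℕ i ≡ toℕ i′
toℕ-lowHalf {d} i {i′} eq = begin
  toℕ i                          ≡⟨ Finₚ.toℕ-cast (double d) i ⟨
  toℕ (Fin.cast (double d) i)    ≡⟨ cong toℕ (Finₚ.splitAt⁻¹-↑ˡ eq) ⟨
  toℕ (i′ Fin.↑ˡ 2 ^ d)          ≡⟨ Finₚ.toℕ-↑ˡ i′ (2 ^ d) ⟩
  toℕ i′                         ∎
  where open ≡-Reasoning

toℕ-highHalf : ∀ {d} (i : Fin (2 ^ suc d)) {i′} → Fin.splitAt (2 ^ d) (Fin.cast (double d) i) ≡ inj₂ i′ → toℕ i ≡ 2 ^ d + toℕ i′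
toℕ-highHalf {d} i {i′} eq = begin
  toℕ i                          ≡⟨ Finₚ.toℕ-cast (double d) i ⟨
  toℕ (Fin.cast (double d) i)    ≡⟨ cong toℕ (Finₚ.splitAt⁻¹-↑ʳ eq) ⟨
  toℕ (2 ^ d Fin.↑ʳ i′)          ≡⟨ Finₚ.toℕ-↑ʳ (2 ^ d) i′ ⟩
  2 ^ d + toℕ i′                 ∎
  where open ≡-Reasoning

M≡Mℕ : ∀ d (i j : Fin (2 ^ d)) → M d i j ≡ Mℕ d (toℕ i) (toℕ j)
M≡Mℕ zero    i j = refl
M≡Mℕ (suc d) i j with Fin.splitAt (2 ^ d) (Fin.cast (double d) i) in eqᵢ
                    | Fin.splitAt (2 ^ d) (Fin.cast (double d) j) in eqⱼ
... | inj₁ i′ | inj₁ j′ rewrite toℕ-lowHalf {d} i eqᵢ | toℕ-lowHalf {d} j eqⱼ =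
  trans (M≡Mℕ d i′ j′) (sym (Mℕ-upperLeft d (Finₚ.toℕ<n i′) (Finₚ.toℕ<n j′)))
... | inj₁ i′ | inj₂ j′ rewrite toℕ-lowHalf {d} i eqᵢ | toℕ-highHalf {d} j eqⱼ =
  trans (M≡Mℕ d i′ j′) (sym (Mℕ-upperRight d (Finₚ.toℕ<n i′)))
... | inj₂ i′ | inj₁ j′ rewrite toℕ-highHalf {d} i eqᵢ | toℕ-lowHalf {d} j eqⱼ =
  sym (Mℕ-lowerLeft d (Finₚ.toℕ<n j′))
... | inj₂ i′ | inj₂ j′ rewrite toℕ-highHalf {d} i eqᵢ | toℕ-highHalf {d} j eqⱼ =
  trans (M≡Mℕ d i′ j′) (sym (Mℕ-lowerRight d))

data Halves (h : ℕ) : ℕ → Set where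
  bothLow : ∀ {x} → suc x < h → Halves h x
  straddle  : ∀ {x} → suc x ≡ h → Halves h x
  bothHigh : ∀ {x} → suc x < h → Halves h (h + x)

halves : ∀ d {x} → suc x < 2 ^ suc d → Halves (2 ^ d) x
halves d {x} sx<2h with half d (<-trans (n<1+n x) sx<2h)
... | low x<h with m≤n⇒m<n∨m≡n x<h
...   | inj₁ sx<h = bothLow sx<h
...   | inj₂ sx≡h = straddle sx≡h
halves d sx<2h | high {x′} _ = bothHigh (+-cancelˡ-< (2 ^ d) (suc x′) (2 ^ d) h+sx′<2h)
  where
  h+sx′<2h : 2 ^ d + suc x′ < 2 ^ d + 2 ^ d
  h+sx′<2h = subst₂ _<_ (sym (+-suc (2 ^ d) x′)) (double d) sx<2h

suc-high : ∀ d {x} → suc (2 ^ d + x) ≡ 2 ^ suc d → suc x ≡ 2 ^ d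
suc-high d {x} eq = +-cancelˡ-≡ (2 ^ d) (suc x) (2 ^ d) (trans (+-suc (2 ^ d) x) (trans eq (double d)))

Mℕ-topRow : ∀ d {j} → j < 2 ^ d → Mℕ d 0 j ≡ true
Mℕ-topRow zero    _   = refl
Mℕ-topRow (suc d) j<2h with half d j<2h
... | low j<h = trans (Mℕ-upperLeft d (m^n>0 2 d) j<h) (Mℕ-topRow d j<h)
... | high j<h = trans (Mℕ-upperRight d (m^n>0 2 d)) (Mℕ-topRow d j<h)

Mℕ-belowDiagonal : ∀ d {i j} → j < i → i < 2 ^ d → Mℕ d i j ≡ false
Mℕ-belowDiagonal zero    {zero}  ()  _
Mℕ-belowDiagonal zero    {suc i} _   (s≤s ())
Mℕ-belowDiagonal (suc d) j<i i<2h with half d i<2h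
... | low i<h = trans (Mℕ-upperLeft d i<h (<-trans j<i i<h)) (Mℕ-belowDiagonal d j<i i<h)
... | high i<h with half d (<-trans j<i i<2h)
...   | low j<h = Mℕ-lowerLeft d j<h
...   | high _   = trans (Mℕ-lowerRight d) (Mℕ-belowDiagonal d (+-cancelˡ-< (2 ^ d) _ _ j<i) i<h)

Mℕ-lastColumn : ∀ d {i j} → suc j ≡ 2 ^ d → i < 2 ^ d → Mℕ d i j ≡ true
Mℕ-lastColumn zero    _     _    = refl
Mℕ-lastColumn (suc d) {j = j} sj≡2h i<2h with half d (subst (j <_) sj≡2h (n<1+n j))
... | low j<h = contradiction (subst (_≤ 2 ^ d) (trans sj≡2h (double d)) j<h)
                                (<⇒≱ (m<m+n (2 ^ d) (m^n>0 2 d)))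
... | high _ with half d i<2h
...   | low i<h = trans (Mℕ-upperRight d i<h) (Mℕ-lastColumn d (suc-high d sj≡2h) i<h)
...   | high i<h = trans (Mℕ-lowerRight d) (Mℕ-lastColumn d (suc-high d sj≡2h) i<h)

PascalRule : ℕ → Set
PascalRule d = ∀ {t j} → suc t < 2 ^ d → suc j < 2 ^ d →
               Mℕ d (suc t) (suc j) ≡ Mℕ d (suc t) j xor Mℕ d t j

module _ (d : ℕ) where
  open ≡-Reasoning

  pascal-upperRows : PascalRule d → ∀ {t j} → suc t < 2 ^ d → Halves (2 ^ d) j →
                     Mℕ (suc d) (suc t) (suc j) ≡ Mℕ (suc d) (suc t) j xor Mℕ (suc d) t j
  pascal-upperRows pascal {t} st<h (bothLow {j} sj<h) = begin
    Mℕ (suc d) (suc t) (suc j)               ≡⟨ Mℕ-upperLeft d st<h sj<h ⟩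
    Mℕ d (suc t) (suc j)                     ≡⟨ pascal st<h sj<h ⟩
    Mℕ d (suc t) j xor Mℕ d t j              ≡⟨ cong₂ _xor_ (Mℕ-upperLeft d st<h j<h) (Mℕ-upperLeft d (<-trans (n<1+n t) st<h) j<h) ⟨
    Mℕ (suc d) (suc t) j xor Mℕ (suc d) t j  ∎
    where j<h = <-trans (n<1+n j) sj<h
  pascal-upperRows pascal {t} st<h (straddle {j} sj≡h) = begin
    Mℕ (suc d) (suc t) (suc j)               ≡⟨ cong (Mℕ (suc d) (suc t)) (trans sj≡h (sym (+-identityʳ (2 ^ d)))) ⟩
    Mℕ (suc d) (suc t) (2 ^ d + 0)           ≡⟨ Mℕ-upperRight d st<h ⟩
    Mℕ d (suc t) 0                           ≡⟨ Mℕ-belowDiagonal d z<s st<h ⟩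
    true xor true                            ≡⟨ cong₂ _xor_ (Mℕ-lastColumn d sj≡h st<h) (Mℕ-lastColumn d sj≡h t<h) ⟨
    Mℕ d (suc t) j xor Mℕ d t j              ≡⟨ cong₂ _xor_ (Mℕ-upperLeft d st<h j<h) (Mℕ-upperLeft d t<h j<h) ⟨
    Mℕ (suc d) (suc t) j xor Mℕ (suc d) t j  ∎
    where t<h = <-trans (n<1+n t) st<h
          j<h = subst (j <_) sj≡h (n<1+n j)
  pascal-upperRows pascal {t} st<h (bothHigh {j} sj<h) = begin
    Mℕ (suc d) (suc t) (suc (2 ^ d + j))     ≡⟨ cong (Mℕ (suc d) (suc t)) (+-suc (2 ^ d) j) ⟨
    Mℕ (suc d) (suc t) (2 ^ d + suc j)       ≡⟨ Mℕ-upperRight d st<h ⟩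
    Mℕ d (suc t) (suc j)                     ≡⟨ pascal st<h sj<h ⟩
    Mℕ d (suc t) j xor Mℕ d t j              ≡⟨ cong₂ _xor_ (Mℕ-upperRight d st<h) (Mℕ-upperRight d (<-trans (n<1+n t) st<h)) ⟨
    Mℕ (suc d) (suc t) (2 ^ d + j) xor Mℕ (suc d) t (2 ^ d + j) ∎

  pascal-middleRows : ∀ {t j} → suc t ≡ 2 ^ d → Halves (2 ^ d) j →
                      Mℕ (suc d) (suc t) (suc j) ≡ Mℕ (suc d) (suc t) j xor Mℕ (suc d) t j
  pascal-middleRows {t} st≡h (bothLow {j} sj<h) = begin
    Mℕ (suc d) (suc t) (suc j)               ≡⟨ cong (λ r → Mℕ (suc d) r (suc j)) st≡h+0 ⟩
    Mℕ (suc d) (2 ^ d + 0) (suc j)           ≡⟨ Mℕ-lowerLeft d sj<h ⟩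
    false xor false                          ≡⟨ cong₂ _xor_ (Mℕ-lowerLeft d j<h) (trans (Mℕ-upperLeft d t<h j<h) (Mℕ-belowDiagonal d j<t t<h)) ⟨
    Mℕ (suc d) (2 ^ d + 0) j xor Mℕ (suc d) t j ≡⟨ cong (λ r → Mℕ (suc d) r j xor Mℕ (suc d) t j) st≡h+0 ⟨
    Mℕ (suc d) (suc t) j xor Mℕ (suc d) t j  ∎
    where st≡h+0 = trans st≡h (sym (+-identityʳ (2 ^ d)))
          t<h = subst (t <_) st≡h (n<1+n t)
          j<h = <-trans (n<1+n j) sj<h
          j<t = s<s⁻¹ (subst (suc (suc j) ≤_) (sym st≡h) sj<h)
  pascal-middleRows {t} st≡h (straddle {j} sj≡h) = begin
    Mℕ (suc d) (suc t) (suc j)               ≡⟨ cong₂ (Mℕ (suc d)) st≡h+0 sj≡h+0 ⟩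
    Mℕ (suc d) (2 ^ d + 0) (2 ^ d + 0)       ≡⟨ Mℕ-lowerRight d ⟩
    Mℕ d 0 0                                 ≡⟨ Mℕ-topRow d (m^n>0 2 d) ⟩
    false xor true                           ≡⟨ cong₂ _xor_ (Mℕ-lowerLeft d j<h) (trans (Mℕ-upperLeft d t<h j<h) (Mℕ-lastColumn d sj≡h t<h)) ⟨
    Mℕ (suc d) (2 ^ d + 0) j xor Mℕ (suc d) t j ≡⟨ cong (λ r → Mℕ (suc d) r j xor Mℕ (suc d) t j) st≡h+0 ⟨
    Mℕ (suc d) (suc t) j xor Mℕ (suc d) t j  ∎
    where st≡h+0 = trans st≡h (sym (+-identityʳ (2 ^ d)))
          sj≡h+0 = trans sj≡h (sym (+-identityʳ (2 ^ d)))
          t<h = subst (t <_) st≡h (n<1+n t)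
          j<h = subst (j <_) sj≡h (n<1+n j)
  pascal-middleRows {t} st≡h (bothHigh {j} sj<h) = begin
    Mℕ (suc d) (suc t) (suc (2 ^ d + j))     ≡⟨ cong₂ (Mℕ (suc d)) st≡h+0 (sym (+-suc (2 ^ d) j)) ⟩
    Mℕ (suc d) (2 ^ d + 0) (2 ^ d + suc j)   ≡⟨ Mℕ-lowerRight d ⟩
    Mℕ d 0 (suc j)                           ≡⟨ Mℕ-topRow d sj<h ⟩
    true xor false                           ≡⟨ cong₂ _xor_ (trans (Mℕ-lowerRight d) (Mℕ-topRow d j<h))
                                                          (trans (Mℕ-upperRight d t<h) (Mℕ-belowDiagonal d j<t t<h)) ⟨
    Mℕ (suc d) (2 ^ d + 0) (2 ^ d + j) xor Mℕ (suc d) t (2 ^ d + j)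
                                             ≡⟨ cong (λ r → Mℕ (suc d) r (2 ^ d + j) xor Mℕ (suc d) t (2 ^ d + j)) st≡h+0 ⟨
    Mℕ (suc d) (suc t) (2 ^ d + j) xor Mℕ (suc d) t (2 ^ d + j) ∎
    where st≡h+0 = trans st≡h (sym (+-identityʳ (2 ^ d)))
          t<h = subst (t <_) st≡h (n<1+n t)
          j<h = <-trans (n<1+n j) sj<h
          j<t = s<s⁻¹ (subst (suc (suc j) ≤_) (sym st≡h) sj<h)

  pascal-lowerRows : PascalRule d → ∀ {t j} → suc t < 2 ^ d → Halves (2 ^ d) j →
                     Mℕ (suc d) (2 ^ d + suc t) (suc j) ≡ Mℕ (suc d) (2 ^ d + suc t) j xor Mℕ (suc d) (2 ^ d + t) j
  pascal-lowerRows pascal {t} st<h (bothLow {j} sj<h) = begin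
    Mℕ (suc d) (2 ^ d + suc t) (suc j)       ≡⟨ Mℕ-lowerLeft d sj<h ⟩
    false xor false                          ≡⟨ cong₂ _xor_ (Mℕ-lowerLeft d j<h) (Mℕ-lowerLeft d j<h) ⟨
    Mℕ (suc d) (2 ^ d + suc t) j xor Mℕ (suc d) (2 ^ d + t) j ∎
    where j<h = <-trans (n<1+n j) sj<h
  pascal-lowerRows pascal {t} st<h (straddle {j} sj≡h) = begin
    Mℕ (suc d) (2 ^ d + suc t) (suc j)       ≡⟨ cong (Mℕ (suc d) (2 ^ d + suc t)) (trans sj≡h (sym (+-identityʳ (2 ^ d)))) ⟩
    Mℕ (suc d) (2 ^ d + suc t) (2 ^ d + 0)   ≡⟨ Mℕ-lowerRight d ⟩
    Mℕ d (suc t) 0                           ≡⟨ Mℕ-belowDiagonal d z<s st<h ⟩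
    false xor false                          ≡⟨ cong₂ _xor_ (Mℕ-lowerLeft d j<h) (Mℕ-lowerLeft d j<h) ⟨
    Mℕ (suc d) (2 ^ d + suc t) j xor Mℕ (suc d) (2 ^ d + t) j ∎
    where j<h = subst (j <_) sj≡h (n<1+n j)
  pascal-lowerRows pascal {t} st<h (bothHigh {j} sj<h) = begin
    Mℕ (suc d) (2 ^ d + suc t) (suc (2 ^ d + j)) ≡⟨ cong (Mℕ (suc d) (2 ^ d + suc t)) (+-suc (2 ^ d) j) ⟨
    Mℕ (suc d) (2 ^ d + suc t) (2 ^ d + suc j)   ≡⟨ Mℕ-lowerRight d ⟩
    Mℕ d (suc t) (suc j)                     ≡⟨ pascal st<h sj<h ⟩
    Mℕ d (suc t) j xor Mℕ d t j              ≡⟨ cong₂ _xor_ (Mℕ-lowerRight d) (Mℕ-lowerRight d) ⟨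
    Mℕ (suc d) (2 ^ d + suc t) (2 ^ d + j) xor Mℕ (suc d) (2 ^ d + t) (2 ^ d + j) ∎

Mℕ-pascal : ∀ d → PascalRule d
Mℕ-pascal zero    (s≤s ()) _
Mℕ-pascal (suc d) {t} {j} st<2h sj<2h with halves d st<2h
... | bothLow st<h = pascal-upperRows d (Mℕ-pascal d) st<h (halves d sj<2h)
... | straddle st≡h  = pascal-middleRows d st≡h (halves d sj<2h)
... | bothHigh {t′} st<h =
  subst (λ r → Mℕ (suc d) r (suc j) ≡ Mℕ (suc d) r j xor Mℕ (suc d) (2 ^ d + t′) j) (+-suc (2 ^ d) t′)
        (pascal-lowerRows d (Mℕ-pascal d) st<h (halves d sj<2h))

Cℕ : ∀ d → ℕ → Vec Bool (2 ^ d)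
Cℕ d t = tabulate (λ i → Mℕ d (toℕ i) t)

lookup-Mcols : ∀ d ns (j : Fin (2 ^ d)) → lookup (Mcols d ns) j ≡ σ^ (lookup ns j) (Cℕ d (toℕ j))
lookup-Mcols d ns j = trans (lookup∘tabulate _ j) (cong (σ^ (lookup ns j)) (tabulate-cong (λ i → M≡Mℕ d i j)))

D-tabulate : (f g : ℕ → Bool) → (∀ {t} → suc t ≡ n → f 0 xor f t ≡ g 0) →
             (∀ {t} → suc t < n → f (suc t) xor f t ≡ g (suc t)) →
             D (tabulate {n = n} (f ∘ toℕ)) ≡ tabulate (g ∘ toℕ)
D-tabulate {zero}  f g _     _    = refl
D-tabulate {suc n} f g first step = lookup-ext _ _ λ i → begin
  lookup (v ⊕ σ v) i                     ≡⟨ lookup-⊕ v (σ v) i ⟩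
  lookup v i xor lookup (σ v) i          ≡⟨ cong (lookup v i xor_) (lookup-σ v i) ⟩
  lookup v i xor lookup v (cyclicPred i) ≡⟨ cong₂ _xor_ (lookup∘tabulate (f ∘ toℕ) i) (lookup∘tabulate (f ∘ toℕ) (cyclicPred i)) ⟩
  f (toℕ i) xor f (toℕ (cyclicPred i))   ≡⟨ entry i ⟩
  g (toℕ i)                              ≡⟨ lookup∘tabulate (g ∘ toℕ) i ⟨
  lookup (tabulate (g ∘ toℕ)) i          ∎
  where
  open ≡-Reasoning
  v = tabulate (f ∘ toℕ)
  entry : ∀ i → f (toℕ i) xor f (toℕ (cyclicPred i)) ≡ g (toℕ i)
  entry Fin.zero    = first (cong suc (Finₚ.toℕ-fromℕ n))
  entry (Fin.suc i) = trans (cong (λ x → f (suc (toℕ i)) xor f x) (Finₚ.toℕ-inject₁ i)) (step (s≤s (Finₚ.toℕ<n i)))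

D-Cℕ : ∀ d {t} → suc t < 2 ^ d → D (Cℕ d t) ≡ Cℕ d (suc t)
D-Cℕ d {t} st<h = D-tabulate (λ i → Mℕ d i t) (λ i → Mℕ d i (suc t)) first step
  where
  first : ∀ {l} → suc l ≡ 2 ^ d → Mℕ d 0 t xor Mℕ d l t ≡ Mℕ d 0 (suc t)
  first {l} sl≡h = begin
    Mℕ d 0 t xor Mℕ d l t  ≡⟨ cong₂ _xor_ (Mℕ-topRow d (<-trans (n<1+n t) st<h)) (Mℕ-belowDiagonal d t<l l<h) ⟩
    true                   ≡⟨ Mℕ-topRow d st<h ⟨
    Mℕ d 0 (suc t)         ∎
    where
    open ≡-Reasoning
    l<h = subst (l <_) sl≡h (n<1+n l)
    t<l = s<s⁻¹ (subst (suc t <_) (sym sl≡h) st<h)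
  step : ∀ {i} → suc i < 2 ^ d → Mℕ d (suc i) t xor Mℕ d i t ≡ Mℕ d (suc i) (suc t)
  step si<h = sym (Mℕ-pascal d si<h st<h)

D^-Cℕ : ∀ d r {t} → r + t < 2 ^ d → D^ r (Cℕ d t) ≡ Cℕ d (r + t)
D^-Cℕ d zero    _   = refl
D^-Cℕ d (suc r) r+t<h = trans (cong D (D^-Cℕ d r (<-trans (n<1+n _) r+t<h))) (D-Cℕ d r+t<h)

Cℕ-lastColumn : ∀ d {t} → suc t ≡ 2 ^ d → Cℕ d t ≡ ones
Cℕ-lastColumn d st≡h = lookup-ext _ _ λ i →
  trans (lookup∘tabulate _ i) (trans (Mℕ-lastColumn d st≡h (Finₚ.toℕ<n i)) (sym (lookup-replicate i true)))

Mcols-DTriangular : ∀ d ns → DTriangular (Mcols d ns)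
Mcols-DTriangular d ns i = begin
  D^ r (lookup (Mcols d ns) i)    ≡⟨ cong (D^ r) (lookup-Mcols d ns i) ⟩
  D^ r (σ^ a (Cℕ d t))            ≡⟨ D^-σ^ r a (Cℕ d t) ⟩
  σ^ a (D^ r (Cℕ d t))            ≡⟨ cong (σ^ a) (D^-Cℕ d r (subst (r + t <_) r+t+1≡h (n<1+n (r + t)))) ⟩
  σ^ a (Cℕ d (r + t))             ≡⟨ cong (σ^ a) (Cℕ-lastColumn d r+t+1≡h) ⟩
  σ^ a ones                       ≡⟨ σ^-replicate a true ⟩
  ones                            ∎
  where
  open ≡-Reasoning
  t = toℕ i
  a = lookup ns i
  r = 2 ^ d ∸ suc t
  r+t+1≡h : suc (r + t) ≡ 2 ^ d
  r+t+1≡h = trans (sym (+-suc r t)) (m∸n+n≡m (Finₚ.toℕ<n i))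

ones≢zeros : 0 < n → ¬ (ones {n} ≡ zeros)
ones≢zeros {suc n} _ ()

Mcols-injective : ∀ d ns (u v : Vec Bool (2 ^ d)) → Mcols d ns · u ≡ Mcols d ns · v → u ≡ v
Mcols-injective d ns = triangular-injective (ones≢zeros (m^n>0 2 d)) (Mcols d ns) (Mcols-DTriangular d ns)

Mcols-sameImage : ∀ d ns ns′ (z : Vec Bool (2 ^ d)) → Σ (Vec Bool (2 ^ d)) λ z′ → Mcols d ns′ · z′ ≡ Mcols d ns · z
Mcols-sameImage d ns ns′ z =
  triangular-image (Mcols d ns′) (Mcols-DTriangular d ns′) (Mcols d ns · z)
                   (D^-kills-image (Mcols d ns) (Mcols-DTriangular d ns) z)

lookup-σ^-shifted : ∀ a (v : Vec Bool n) (i : Fin n) → a ≤ toℕ i →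
                    Σ (Fin n) λ j → toℕ j + a ≡ toℕ i × lookup (σ^ a v) i ≡ lookup v j
lookup-σ^-shifted zero    v i           _        = i , +-identityʳ (toℕ i) , refl
lookup-σ^-shifted (suc a) v (Fin.suc i) (s≤s a≤i)
  with j , j+a≡i , eq ← lookup-σ^-shifted a v (inject₁ i) (subst (a ≤_) (sym (Finₚ.toℕ-inject₁ i)) a≤i) =
  j , trans (+-suc (toℕ j) a) (cong suc (trans j+a≡i (Finₚ.toℕ-inject₁ i))) ,
  trans (lookup-σ (σ^ a v) (Fin.suc i)) eq

-- The first a entries of σ^ a v come from the last a entries of v, which vanish when a + t < n.
lookup-σ^-wrapped : ∀ {t} (v : Vec Bool n) → (∀ j → t < toℕ j → lookup v j ≡ false) →
                    ∀ a → a + t < n → ∀ i → toℕ i < a → lookup (σ^ a v) i ≡ false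
lookup-σ^-wrapped v vanish (suc a) sa+t<n (Fin.suc i) (s≤s i<a) =
  trans (lookup-σ (σ^ a v) (Fin.suc i))
        (lookup-σ^-wrapped v vanish a (<-trans (n<1+n _) sa+t<n) (inject₁ i) (subst (_< a) (sym (Finₚ.toℕ-inject₁ i)) i<a))
lookup-σ^-wrapped {suc n} {t} v vanish (suc a) sa+t<n Fin.zero _ =
  let j , j+a≡n , eq = lookup-σ^-shifted a v (fromℕ n) (subst (a ≤_) (sym (Finₚ.toℕ-fromℕ n)) a≤n)
  in trans (lookup-σ (σ^ a v) Fin.zero) (trans eq (vanish j (t<j j+a≡n)))
  where
  a+t<n : suc (a + t) ≤ n
  a+t<n = s≤s⁻¹ sa+t<n
  a≤n : a ≤ n
  a≤n = ≤-trans (m≤m+n a t) (<⇒≤ a+t<n)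
  t<j : ∀ {j : Fin (suc n)} → toℕ j + a ≡ toℕ (fromℕ n) → t < toℕ j
  t<j {j} j+a≡n = +-cancelʳ-< a t (toℕ j) (subst₂ _<_ (+-comm a t) (sym (trans j+a≡n (Finₚ.toℕ-fromℕ n))) a+t<n)

σ^-distinct : ∀ {t a b} (v : Vec Bool n) → (∀ j → toℕ j ≡ 0 → lookup v j ≡ true) →
              (∀ j → t < toℕ j → lookup v j ≡ false) → a < b → b + t < n → σ^ a v ≢ σ^ b v
σ^-distinct {t = t} {a} {b} v head vanish a<b b+t<n eq = contradiction (begin
  true                  ≡⟨ trans eq′ (head j (+-cancelʳ-≡ a (toℕ j) 0 (trans j+a≡a toℕ-iₐ))) ⟨
  lookup (σ^ a v) iₐ    ≡⟨ cong (λ w → lookup w iₐ) eq ⟩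
  lookup (σ^ b v) iₐ    ≡⟨ lookup-σ^-wrapped v vanish b b+t<n iₐ (subst (_< b) (sym toℕ-iₐ) a<b) ⟩
  false                 ∎) λ ()
  where
  open ≡-Reasoning
  a<n = <-≤-trans a<b (≤-trans (m≤m+n b t) (<⇒≤ b+t<n))
  iₐ = Fin.fromℕ< a<n
  toℕ-iₐ = Finₚ.toℕ-fromℕ< a<n
  shifted = lookup-σ^-shifted a v iₐ (≤-reflexive (sym toℕ-iₐ))
  j = proj₁ shifted
  j+a≡a = proj₁ (proj₂ shifted)
  eq′ = proj₂ (proj₂ shifted)

σ^-exponent-injective : ∀ {t a b} (v : Vec Bool n) → (∀ j → toℕ j ≡ 0 → lookup v j ≡ true) →
                        (∀ j → t < toℕ j → lookup v j ≡ false) →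
                        a + t < n → b + t < n → σ^ a v ≡ σ^ b v → a ≡ b
σ^-exponent-injective {a = a} {b} v head vanish a+t<n b+t<n eq with <-cmp a b
... | tri< a<b _ _ = contradiction eq (σ^-distinct v head vanish a<b b+t<n)
... | tri≈ _ a≡b _ = a≡b
... | tri> _ _ b<a = contradiction (sym eq) (σ^-distinct v head vanish b<a a+t<n)

Cℕ-σ^-injective : ∀ d {t a b} → a + t < 2 ^ d → b + t < 2 ^ d → σ^ a (Cℕ d t) ≡ σ^ b (Cℕ d t) → a ≡ b
Cℕ-σ^-injective d {t} {a} a+t<h = σ^-exponent-injective (Cℕ d t) head vanish a+t<h
  where
  head : ∀ j → toℕ j ≡ 0 → lookup (Cℕ d t) j ≡ true
  head j j≡0 = trans (lookup∘tabulate _ j) (trans (cong (λ i → Mℕ d i t) j≡0) (Mℕ-topRow d (≤-<-trans (m≤n+m t a) a+t<h)))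
  vanish : ∀ j → t < toℕ j → lookup (Cℕ d t) j ≡ false
  vanish j t<j = trans (lookup∘tabulate _ j) (Mℕ-belowDiagonal d t<j (Finₚ.toℕ<n j))

-- Windows and lexicographic prefixes

AgreeOnLast : {A : Set} → ℕ → Vec A n → Vec A n → Set
AgreeOnLast {n = n} k u v = ∀ i → n ≤ toℕ i + k → lookup u i ≡ lookup v i

SupportedOnLast : ℕ → Vec Bool n → Set
SupportedOnLast {n = n} k w = ∀ i → toℕ i + k < n → lookup w i ≡ false

lexWords-complete : (w : Vec Bool n) → w ∈ lexWords n
lexWords-complete []          = here refl
lexWords-complete (false ∷ w) = ∈-++⁺ˡ (∈-map⁺ (false ∷_) (lexWords-complete w))
lexWords-complete (true ∷ w)  = ∈-++⁺ʳ (map (false ∷_) (lexWords _)) (∈-map⁺ (true ∷_) (lexWords-complete w))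

lexWords-unique : ∀ n → Unique (lexWords n)
lexWords-unique zero    = All.[] AllPairs.∷ AllPairs.[]
lexWords-unique (suc n) = Uniqueₚ.++⁺ (Uniqueₚ.map⁺ ∷-injectiveʳ (lexWords-unique n))
                                      (Uniqueₚ.map⁺ ∷-injectiveʳ (lexWords-unique n)) disjoint
  where
  disjoint : ∀ {w} → w ∈ map (false ∷_) (lexWords n) × w ∈ map (true ∷_) (lexWords n) → ⊥
  disjoint (p , q) with ∈-map⁻ (false ∷_) p | ∈-map⁻ (true ∷_) q
  ... | _ , _ , refl | _ , _ , ()

length-lexWords : ∀ n → length (lexWords n) ≡ 2 ^ n
length-lexWords zero    = refl
length-lexWords (suc n) = begin
  length (map (false ∷_) (lexWords n) ++ map (true ∷_) (lexWords n))
    ≡⟨ Listₚ.length-++ (map (false ∷_) (lexWords n)) ⟩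
  length (map (false ∷_) (lexWords n)) + length (map (true ∷_) (lexWords n))
    ≡⟨ cong₂ _+_ (Listₚ.length-map _ (lexWords n)) (Listₚ.length-map _ (lexWords n)) ⟩
  length (lexWords n) + length (lexWords n)
    ≡⟨ cong₂ _+_ (length-lexWords n) (trans (length-lexWords n) (sym (+-identityʳ _))) ⟩
  2 ^ suc n ∎
  where open ≡-Reasoning

take-++-≤ : {A : Set} (j : ℕ) (xs ys : List A) → j ≤ length xs → take j (xs ++ ys) ≡ take j xs
take-++-≤ zero    xs       ys _         = refl
take-++-≤ (suc j) (x ∷ xs) ys (s≤s j≤) = cong (x ∷_) (take-++-≤ j xs ys j≤)

take-lexWords-suc : ∀ {n k} → k ≤ n → take (2 ^ k) (lexWords (suc n)) ≡ map (false ∷_) (take (2 ^ k) (lexWords n))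
take-lexWords-suc {n} {k} k≤n = begin
  take (2 ^ k) (map (false ∷_) (lexWords n) ++ map (true ∷_) (lexWords n))
    ≡⟨ take-++-≤ (2 ^ k) _ _ (subst (2 ^ k ≤_) (sym length-first-half) (^-monoʳ-≤ 2 k≤n)) ⟩
  take (2 ^ k) (map (false ∷_) (lexWords n))
    ≡⟨ Listₚ.take-map (2 ^ k) (lexWords n) ⟩
  map (false ∷_) (take (2 ^ k) (lexWords n)) ∎
  where
  open ≡-Reasoning
  length-first-half : length (map (false ∷_) (lexWords n)) ≡ 2 ^ n
  length-first-half = trans (Listₚ.length-map _ (lexWords n)) (length-lexWords n)

∈-lexPrefix⁻ : ∀ {n k} → k ≤ n → (w : Vec Bool n) → w ∈ take (2 ^ k) (lexWords n) → SupportedOnLast k w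
∈-lexPrefix⁻ {n} {k} k≤n w w∈ with m≤n⇒m<n∨m≡n k≤n
... | inj₂ refl = λ i i+k<k → contradiction i+k<k (m+n≮n (toℕ i) k)
∈-lexPrefix⁻ {suc n} k≤n w w∈ | inj₁ (s≤s k≤n′) with ∈-map⁻ (false ∷_) (subst (w ∈_) (take-lexWords-suc k≤n′) w∈)
... | w′ , w′∈ , refl = supported
  where
  supported : SupportedOnLast _ (false ∷ w′)
  supported Fin.zero    _         = refl
  supported (Fin.suc i) (s≤s i+k<n) = ∈-lexPrefix⁻ k≤n′ w′ w′∈ i i+k<n

∈-lexPrefix⁺ : ∀ {n k} → k ≤ n → (w : Vec Bool n) → SupportedOnLast k w → w ∈ take (2 ^ k) (lexWords n)
∈-lexPrefix⁺ {n} {k} k≤n w supp with m≤n⇒m<n∨m≡n k≤n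
... | inj₂ refl = subst (w ∈_) (sym (Listₚ.take-all (2 ^ n) (lexWords n) (≤-reflexive (length-lexWords n))))
                        (lexWords-complete w)
∈-lexPrefix⁺ {suc n} k≤n (x ∷ w) supp | inj₁ (s≤s k≤n′) =
  subst ((x ∷ w) ∈_) (sym (take-lexWords-suc k≤n′))
        (subst (λ y → (y ∷ w) ∈ _) (sym (supp Fin.zero (s≤s k≤n′)))
               (∈-map⁺ (false ∷_) (∈-lexPrefix⁺ k≤n′ w (λ i i+k<n → supp (Fin.suc i) (s≤s i+k<n)))))

-- necklace d k ns z is affineWord (Mcols d ns) k z by definition.
affineWord : ∀ {r} → Vec (Vec Bool r) n → ℕ → Vec Bool n → List Bool
affineWord {n} A k z = concatMap (λ w → Vec.toList (A · (w ⊕ z))) (take (2 ^ k) (lexWords n))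

basis : Fin n → Vec Bool n
basis Fin.zero    = true ∷ zeros
basis (Fin.suc j) = false ∷ basis j

·-basis : ∀ {r} (A : Vec (Vec Bool r) n) j → A · basis j ≡ lookup A j
·-basis (c ∷ A) Fin.zero    = trans (cong (c ⊕_) (·-zeros A)) (⊕-identityʳ c)
·-basis (c ∷ A) (Fin.suc j) = trans (⊕-identityˡ _) (·-basis A j)

lookup-basis : ∀ (j i : Fin n) → toℕ i ≢ toℕ j → lookup (basis j) i ≡ false
lookup-basis Fin.zero    Fin.zero    i≢j = contradiction refl i≢j
lookup-basis Fin.zero    (Fin.suc i) _   = lookup-replicate i false
lookup-basis (Fin.suc j) Fin.zero    _   = refl
lookup-basis (Fin.suc j) (Fin.suc i) i≢j = lookup-basis j i (i≢j ∘ cong suc)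

basis-supportedOnLast : ∀ {k} (j : Fin n) → n ≤ toℕ j + k → SupportedOnLast k (basis j)
basis-supportedOnLast j n≤j+k i i+k<n = lookup-basis j i λ i≡j → <⇒≱ i+k<n (subst (λ x → _ ≤ x + _) (sym i≡j) n≤j+k)

·-agreeOnLast : ∀ {r k} (A A′ : Vec (Vec Bool r) n) w → SupportedOnLast k w → AgreeOnLast k A A′ → A · w ≡ A′ · w
·-agreeOnLast []       []         []      _    _     = refl
·-agreeOnLast {suc n} {k = k} (c ∷ A) (c′ ∷ A′) (b ∷ w) supp agree =
  cong₂ _⊕_ first (·-agreeOnLast A A′ w (λ i → supp (Fin.suc i) ∘ s≤s) (λ i → agree (Fin.suc i) ∘ s≤s))
  where
  first : select b c ≡ select b c′
  first with suc n ≤? k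
  ... | yes n<k = cong (select b) (agree Fin.zero n<k)
  ... | no  n≮k rewrite supp Fin.zero (≰⇒> n≮k) = refl

++-cancel-sameLength : {A : Set} (xs ys zs ws : List A) → length xs ≡ length ys →
                       xs ++ zs ≡ ys ++ ws → xs ≡ ys × zs ≡ ws
++-cancel-sameLength []       []       zs ws _   eq = refl , eq
++-cancel-sameLength (x ∷ xs) (y ∷ ys) zs ws len eq with refl ← Listₚ.∷-injectiveˡ eq =
  map₁ (cong (x ∷_)) (++-cancel-sameLength xs ys zs ws (suc-injective len) (Listₚ.∷-injectiveʳ eq))

concatMap-cancel : {A B : Set} (f g : A → List B) → (∀ x → length (f x) ≡ length (g x)) →
                   ∀ xs → concatMap f xs ≡ concatMap g xs → All (λ x → f x ≡ g x) xs
concatMap-cancel f g len []       _  = All.[]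
concatMap-cancel f g len (x ∷ xs) eq =
  let fx≡gx , rest = ++-cancel-sameLength (f x) (g x) _ _ (len x) eq
  in fx≡gx All.∷ concatMap-cancel f g len xs rest

module _ {r k : ℕ} (k≤n : k ≤ n) (A A′ : Vec (Vec Bool r) n) (z z′ : Vec Bool n) where

  affineWord-cong : AgreeOnLast k A A′ → A · z ≡ A′ · z′ → affineWord A k z ≡ affineWord A′ k z′
  affineWord-cong agree Az≡A′z′ = cong List.concat (Listₚ.map-cong-local (All.tabulate block))
    where
    block : ∀ {w} → w ∈ take (2 ^ k) (lexWords n) → Vec.toList (A · (w ⊕ z)) ≡ Vec.toList (A′ · (w ⊕ z′))
    block {w} w∈ = cong Vec.toList (begin
      A · (w ⊕ z)            ≡⟨ ·-⊕ A w z ⟩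
      (A · w) ⊕ (A · z)      ≡⟨ cong₂ _⊕_ (·-agreeOnLast A A′ w (∈-lexPrefix⁻ k≤n w w∈) agree) Az≡A′z′ ⟩
      (A′ · w) ⊕ (A′ · z′)   ≡⟨ ·-⊕ A′ w z′ ⟨
      A′ · (w ⊕ z′)          ∎)
      where open ≡-Reasoning

  -- The block of the zero word gives A z, and the blocks of the basis words in the window give the columns.
  affineWord-injective : affineWord A k z ≡ affineWord A′ k z′ → A · z ≡ A′ · z′ × AgreeOnLast k A A′
  affineWord-injective eq = Az≡A′z′ , agree
    where
    blocks : All (λ w → A · (w ⊕ z) ≡ A′ · (w ⊕ z′)) (take (2 ^ k) (lexWords n))
    blocks = All.map (λ {w} → trans (sym (cast-is-id refl _)) ∘ toList-injective refl _ _)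
                     (concatMap-cancel (λ w → Vec.toList (A · (w ⊕ z))) (λ w → Vec.toList (A′ · (w ⊕ z′)))
                                       (λ w → trans (length-toList (A · (w ⊕ z))) (sym (length-toList (A′ · (w ⊕ z′)))))
                                       _ eq)
    block : ∀ w → SupportedOnLast k w → A · (w ⊕ z) ≡ A′ · (w ⊕ z′)
    block w supp = All.lookup blocks (∈-lexPrefix⁺ k≤n w supp)
    Az≡A′z′ : A · z ≡ A′ · z′
    Az≡A′z′ = subst₂ (λ u u′ → A · u ≡ A′ · u′) (⊕-identityˡ z) (⊕-identityˡ z′)
                     (block zeros λ i _ → lookup-replicate i false)
    agree : AgreeOnLast k A A′
    agree j n≤j+k = begin
      lookup A j       ≡⟨ ·-basis A j ⟨
      A · basis j      ≡⟨ ⊕-cancelˡ (A · z) _ _ (begin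
        (A · z) ⊕ (A · basis j)     ≡⟨ ⊕-comm _ _ ⟩
        (A · basis j) ⊕ (A · z)     ≡⟨ ·-⊕ A (basis j) z ⟨
        A · (basis j ⊕ z)           ≡⟨ block (basis j) (basis-supportedOnLast j n≤j+k) ⟩
        A′ · (basis j ⊕ z′)         ≡⟨ ·-⊕ A′ (basis j) z′ ⟩
        (A′ · basis j) ⊕ (A′ · z′)  ≡⟨ cong (_ ⊕_) Az≡A′z′ ⟨
        (A′ · basis j) ⊕ (A · z)    ≡⟨ ⊕-comm _ _ ⟩
        (A · z) ⊕ (A′ · basis j)    ∎) ⟩
      A′ · basis j     ≡⟨ ·-basis A′ j ⟩
      lookup A′ j      ∎
      where open ≡-Reasoning

-- Admissible exponent sequences

Admissible-bound : (ns : Vec ℕ n) → Admissible ns → ∀ i → lookup ns i + toℕ i < n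
Admissible-bound (x ∷ [])     refl              Fin.zero    = s≤s z≤n
Admissible-bound (x ∷ y ∷ ys) (_ , x≤1+y , adm) Fin.zero    =
  s≤s (≤-trans (subst (_≤ suc y) (sym (+-identityʳ x)) x≤1+y)
               (subst (λ u → suc u ≤ _) (+-identityʳ y) (Admissible-bound (y ∷ ys) adm Fin.zero)))
Admissible-bound {suc (suc n)} (x ∷ y ∷ ys) (_ , _ , adm) (Fin.suc i) =
  subst (_< suc (suc n)) (sym (+-suc (lookup (y ∷ ys) i) (toℕ i))) (s≤s (Admissible-bound (y ∷ ys) adm i))

Mcols-agreeOnLast⁺ : ∀ d {k} ns ns′ → AgreeOnLast k ns ns′ → AgreeOnLast k (Mcols d ns) (Mcols d ns′)
Mcols-agreeOnLast⁺ d ns ns′ agree i in-window = begin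
  lookup (Mcols d ns) i                    ≡⟨ lookup-Mcols d ns i ⟩
  σ^ (lookup ns i) (Cℕ d (toℕ i))          ≡⟨ cong (λ a → σ^ a (Cℕ d (toℕ i))) (agree i in-window) ⟩
  σ^ (lookup ns′ i) (Cℕ d (toℕ i))         ≡⟨ lookup-Mcols d ns′ i ⟨
  lookup (Mcols d ns′) i                   ∎
  where open ≡-Reasoning

Mcols-agreeOnLast⁻ : ∀ d {k} ns ns′ → Admissible ns → Admissible ns′ →
                     AgreeOnLast k (Mcols d ns) (Mcols d ns′) → AgreeOnLast k ns ns′
Mcols-agreeOnLast⁻ d ns ns′ adm adm′ agree i in-window =
  Cℕ-σ^-injective d (Admissible-bound ns adm i) (Admissible-bound ns′ adm′ i)
    (trans (sym (lookup-Mcols d ns i)) (trans (agree i in-window) (lookup-Mcols d ns′ i)))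

bit : Bool → ℕ
bit false = 0
bit true  = 1

-- Entry i of heights w counts the trues of w strictly after position i; the first entry of w is ignored.
heights : Vec Bool n → Vec ℕ n
heights []           = []
heights (_ ∷ [])     = 0 ∷ []
heights (_ ∷ c ∷ cs) = (bit c + lookup (heights (c ∷ cs)) Fin.zero) ∷ heights (c ∷ cs)

descent : ℕ → ℕ → Bool
descent x y with x ≟ y
... | yes _ = false
... | no  _ = true

descentsFrom : ℕ → Vec ℕ n → Vec Bool n
descentsFrom x []       = []
descentsFrom x (y ∷ ys) = descent x y ∷ descentsFrom y ys

descents : Vec ℕ n → Vec Bool n
descents []       = []
descents (x ∷ xs) = false ∷ descentsFrom x xs

heights-admissible : (w : Vec Bool n) → Admissible (heights w)
heights-admissible []           = _
heights-admissible (_ ∷ [])     = refl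
heights-admissible (_ ∷ c ∷ cs) = admissible-∷ (heights (c ∷ cs)) (heights-admissible (c ∷ cs))
  where
  bit≤1 : ∀ c → bit c ≤ 1
  bit≤1 false = z≤n
  bit≤1 true  = ≤-refl
  admissible-∷ : ∀ {n} (v : Vec ℕ (suc n)) → Admissible v → Admissible ((bit c + lookup v Fin.zero) ∷ v)
  admissible-∷ (y ∷ ys) adm = m≤n+m y (bit c) , +-monoˡ-≤ y (bit≤1 c) , adm

heights-head-irrelevant : ∀ b b′ (w : Vec Bool n) → heights (b ∷ w) ≡ heights (b′ ∷ w)
heights-head-irrelevant b b′ []      = refl
heights-head-irrelevant b b′ (_ ∷ _) = refl

heights-descents : (ns : Vec ℕ n) → Admissible ns → heights (descents ns) ≡ ns
heights-descents []           _                   = refl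
heights-descents (x ∷ [])     x≡0                 = cong (_∷ []) (sym x≡0)
heights-descents (x ∷ y ∷ ys) (y≤x , x≤1+y , adm) = begin
  (bit c + lookup (heights (c ∷ ds)) Fin.zero) ∷ heights (c ∷ ds)
    ≡⟨ cong (λ v → (bit c + lookup v Fin.zero) ∷ v) (trans (heights-head-irrelevant c false ds) (heights-descents (y ∷ ys) adm)) ⟩
  (bit c + y) ∷ y ∷ ys
    ≡⟨ cong (_∷ y ∷ ys) descent-step ⟩
  x ∷ y ∷ ys ∎
  where
  open ≡-Reasoning
  c = descent x y
  ds = descentsFrom y ys
  descent-step : bit (descent x y) + y ≡ x
  descent-step with x ≟ y
  ... | yes x≡y = sym x≡y
  ... | no  x≢y = ≤-antisym (≤∧≢⇒< y≤x (x≢y ∘ sym)) x≤1+y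

descent-bit : ∀ c h → descent (bit c + h) h ≡ c
descent-bit false h with h ≟ h
... | yes _   = refl
... | no  h≢h = contradiction refl h≢h
descent-bit true h with suc h ≟ h
... | yes sh≡h = contradiction sh≡h 1+n≢n
... | no  _    = refl

descentsFrom-heights : ∀ c (cs : Vec Bool n) → descentsFrom (bit c + lookup (heights (c ∷ cs)) Fin.zero) (heights (c ∷ cs)) ≡ c ∷ cs
descentsFrom-heights c []        = cong (_∷ []) (descent-bit c 0)
descentsFrom-heights c (c′ ∷ cs) = cong₂ _∷_ (descent-bit c _) (descentsFrom-heights c′ cs)

descents-heights : ∀ b (w : Vec Bool n) → descents (heights (b ∷ w)) ≡ false ∷ w
descents-heights b []       = refl
descents-heights b (c ∷ cs) = cong (false ∷_) (descentsFrom-heights c cs)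

heights-agreeOnLast : ∀ {k} (w w′ : Vec Bool n) → AgreeOnLast k w w′ → AgreeOnLast (suc k) (heights w) (heights w′)
heights-agreeOnLast (_ ∷ [])     (_ ∷ [])       _     Fin.zero    _ = refl
heights-agreeOnLast (_ ∷ c ∷ cs) (_ ∷ c′ ∷ cs′) agree Fin.zero    (s≤s m<k) =
  cong₂ _+_ (cong bit (agree (Fin.suc Fin.zero) (s≤s m<k)))
            (heights-agreeOnLast (c ∷ cs) (c′ ∷ cs′) (λ i → agree (Fin.suc i) ∘ s≤s) Fin.zero (≤-trans m<k (n≤1+n _)))
heights-agreeOnLast (_ ∷ c ∷ cs) (_ ∷ c′ ∷ cs′) agree (Fin.suc i) (s≤s in-window) =
  heights-agreeOnLast (c ∷ cs) (c′ ∷ cs′) (λ i → agree (Fin.suc i) ∘ s≤s) i in-window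

descentsFrom-agreeOnLast : ∀ {k} x x′ (ys ys′ : Vec ℕ n) → (n ≤ k → x ≡ x′) → AgreeOnLast (suc k) ys ys′ →
                           AgreeOnLast k (descentsFrom x ys) (descentsFrom x′ ys′)
descentsFrom-agreeOnLast x x′ (y ∷ ys) (y′ ∷ ys′) x≡x′ agree Fin.zero    n≤k =
  cong₂ descent (x≡x′ n≤k) (agree Fin.zero (≤-trans n≤k (n≤1+n _)))
descentsFrom-agreeOnLast x x′ (y ∷ ys) (y′ ∷ ys′) x≡x′ agree (Fin.suc i) (s≤s in-window) =
  descentsFrom-agreeOnLast y y′ ys ys′ (agree Fin.zero ∘ s≤s) (λ i → agree (Fin.suc i) ∘ s≤s) i in-window

descents-agreeOnLast : ∀ {k} (ns ns′ : Vec ℕ n) → AgreeOnLast (suc k) ns ns′ → AgreeOnLast k (descents ns) (descents ns′)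
descents-agreeOnLast (x ∷ xs) (x′ ∷ xs′) agree Fin.zero    _ = refl
descents-agreeOnLast (x ∷ xs) (x′ ∷ xs′) agree (Fin.suc i) (s≤s in-window) =
  descentsFrom-agreeOnLast x x′ xs xs′ (agree Fin.zero ∘ s≤s) (λ i → agree (Fin.suc i) ∘ s≤s) i in-window

keepLast : ℕ → Vec Bool n → Vec Bool n
keepLast k []               = []
keepLast {suc n} k (b ∷ w) with suc n ≤? k
... | yes _ = b ∷ keepLast k w
... | no  _ = false ∷ keepLast k w

keepLast-supportedOnLast : ∀ k (w : Vec Bool n) → SupportedOnLast k (keepLast k w)
keepLast-supportedOnLast {suc n} k (b ∷ w) i i+k<n with suc n ≤? k | i
... | yes n<k | Fin.zero  = contradiction n<k (<⇒≱ i+k<n)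
... | no  _   | Fin.zero  = refl
... | yes _   | Fin.suc i = keepLast-supportedOnLast k w i (s≤s⁻¹ i+k<n)
... | no  _   | Fin.suc i = keepLast-supportedOnLast k w i (s≤s⁻¹ i+k<n)

keepLast-agreeOnLast : ∀ k (w : Vec Bool n) → AgreeOnLast k (keepLast k w) w
keepLast-agreeOnLast {suc n} k (b ∷ w) i in-window with suc n ≤? k | i
... | yes _   | Fin.zero  = refl
... | no  n≰k | Fin.zero  = contradiction in-window n≰k
... | yes _   | Fin.suc i = keepLast-agreeOnLast k w i (s≤s⁻¹ in-window)
... | no  _   | Fin.suc i = keepLast-agreeOnLast k w i (s≤s⁻¹ in-window)

supportedOnLast-agree⇒≡ : ∀ {k} (u v : Vec Bool n) → SupportedOnLast k u → SupportedOnLast k v → AgreeOnLast k u v → u ≡ v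
supportedOnLast-agree⇒≡ {n} {k} u v supp-u supp-v agree = lookup-ext u v entry
  where
  entry : ∀ i → lookup u i ≡ lookup v i
  entry i with n ≤? toℕ i + k
  ... | yes in-window = agree i in-window
  ... | no  outside   = trans (supp-u i (≰⇒> outside)) (sym (supp-v i (≰⇒> outside)))

heights-keepLast-descents : ∀ k (ns : Vec ℕ n) → Admissible ns → AgreeOnLast (suc k) (heights (keepLast k (descents ns))) ns
heights-keepLast-descents k ns adm i in-window =
  trans (heights-agreeOnLast (keepLast k (descents ns)) (descents ns) (keepLast-agreeOnLast k (descents ns)) i in-window)
        (cong (λ v → lookup v i) (heights-descents ns adm))

heights-injectiveOnLast : ∀ {k} → k < n → (w w′ : Vec Bool n) → SupportedOnLast k w → SupportedOnLast k w′ →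
                          AgreeOnLast (suc k) (heights w) (heights w′) → w ≡ w′
heights-injectiveOnLast k<n (b ∷ u) (b′ ∷ u′) supp supp′ agree =
  cong₂ _∷_ (trans (supp Fin.zero k<n) (sym (supp′ Fin.zero k<n)))
            (supportedOnLast-agree⇒≡ u u′ (λ i → supp (Fin.suc i) ∘ s≤s) (λ i → supp′ (Fin.suc i) ∘ s≤s) tails-agree)
  where
  tails-agree : AgreeOnLast _ u u′
  tails-agree i in-window =
    subst₂ (λ v v′ → lookup v (Fin.suc i) ≡ lookup v′ (Fin.suc i)) (descents-heights b u) (descents-heights b′ u′)
           (descents-agreeOnLast (heights (b ∷ u)) (heights (b′ ∷ u′)) agree (Fin.suc i) (s≤s in-window))

-- Counting the necklaces

length-cartesianProduct : {A B : Set} (xs : List A) (ys : List B) → length (cartesianProduct xs ys) ≡ length xs * length ys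
length-cartesianProduct []       ys = refl
length-cartesianProduct (x ∷ xs) ys =
  trans (Listₚ.length-++ (map (x ,_) ys)) (cong₂ _+_ (Listₚ.length-map _ ys) (length-cartesianProduct xs ys))

unique-map⁺-injectiveOn : {A B : Set} {f : A → B} {xs : List A} →
                          (∀ {x y} → x ∈ xs → y ∈ xs → f x ≡ f y → x ≡ y) → Unique xs → Unique (map f xs)
unique-map⁺-injectiveOn {xs = []}     _   AllPairs.[]           = AllPairs.[]
unique-map⁺-injectiveOn {xs = x ∷ xs} inj (x∉xs AllPairs.∷ uxs) =
  Allₚ.map⁺ (All.tabulate λ y∈xs fx≡fy → All.lookup x∉xs y∈xs (inj (here refl) (there y∈xs) fx≡fy))
  AllPairs.∷ unique-map⁺-injectiveOn (λ x∈ y∈ → inj (there x∈) (there y∈)) uxs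

-- A (k + 1, 2 ^ d)-affine necklace is parametrised by a word supported on its last k positions, whose
-- heights give the last k + 1 exponents, and by z.
necklaceParameters : ∀ d k → List (Vec Bool (2 ^ d) × Vec Bool (2 ^ d))
necklaceParameters d k = cartesianProduct (take (2 ^ k) (lexWords (2 ^ d))) (lexWords (2 ^ d))

necklaceOf : ∀ d k → Vec Bool (2 ^ d) × Vec Bool (2 ^ d) → List Bool
necklaceOf d k (w , z) = necklace d (suc k) (heights w) z

length-necklaceParameters : ∀ d {k} → k ≤ 2 ^ d → length (necklaceParameters d k) ≡ 2 ^ (k + 2 ^ d)
length-necklaceParameters d {k} k≤m = begin
  length (cartesianProduct (take (2 ^ k) (lexWords (2 ^ d))) (lexWords (2 ^ d)))
    ≡⟨ length-cartesianProduct (take (2 ^ k) (lexWords (2 ^ d))) (lexWords (2 ^ d)) ⟩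
  length (take (2 ^ k) (lexWords (2 ^ d))) * length (lexWords (2 ^ d))
    ≡⟨ cong₂ _*_ (Listₚ.length-take (2 ^ k) (lexWords (2 ^ d))) (length-lexWords (2 ^ d)) ⟩
  (2 ^ k ⊓ length (lexWords (2 ^ d))) * 2 ^ 2 ^ d
    ≡⟨ cong (λ l → (2 ^ k ⊓ l) * 2 ^ 2 ^ d) (length-lexWords (2 ^ d)) ⟩
  (2 ^ k ⊓ 2 ^ 2 ^ d) * 2 ^ 2 ^ d
    ≡⟨ cong (_* 2 ^ 2 ^ d) (m≤n⇒m⊓n≡m (^-monoʳ-≤ 2 k≤m)) ⟩
  2 ^ k * 2 ^ 2 ^ d
    ≡⟨ ^-distribˡ-+-* 2 k (2 ^ d) ⟨
  2 ^ (k + 2 ^ d) ∎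
  where open ≡-Reasoning

necklaceParameters-unique : ∀ d k → Unique (necklaceParameters d k)
necklaceParameters-unique d k =
  Uniqueₚ.cartesianProduct⁺ (Uniqueₚ.take⁺ (2 ^ k) (lexWords-unique (2 ^ d))) (lexWords-unique (2 ^ d))

necklaceOf-injective : ∀ d {k} → k < 2 ^ d → ∀ {p q} → p ∈ necklaceParameters d k → q ∈ necklaceParameters d k →
                       necklaceOf d k p ≡ necklaceOf d k q → p ≡ q
necklaceOf-injective d {k} k<m {w , z} {w′ , z′} p∈ q∈ eq = cong₂ _,_ w≡w′ z≡z′
  where
  A = Mcols d (heights w)
  A′ = Mcols d (heights w′)
  determined = affineWord-injective k<m A A′ z z′ eq
  supported : ∀ {v y} → (v , y) ∈ necklaceParameters d k → SupportedOnLast k v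
  supported {v} v∈ = ∈-lexPrefix⁻ (<⇒≤ k<m) v (proj₁ (∈-cartesianProduct⁻ _ _ v∈))
  w≡w′ : w ≡ w′
  w≡w′ = heights-injectiveOnLast k<m w w′ (supported p∈) (supported q∈)
           (Mcols-agreeOnLast⁻ d (heights w) (heights w′) (heights-admissible w) (heights-admissible w′) (proj₂ determined))
  z≡z′ : z ≡ z′
  z≡z′ = Mcols-injective d (heights w) z z′ (trans (proj₁ determined) (cong (λ v → Mcols d (heights v) · z′) (sym w≡w′)))

necklaceOf-surjective : ∀ d {k} → k < 2 ^ d → ∀ ns → Admissible ns → ∀ z →
                        Σ _ λ p → p ∈ necklaceParameters d k × necklaceOf d k p ≡ necklace d (suc k) ns z
necklaceOf-surjective d {k} k<m ns adm z = (w , z′) , p∈ , affineWord-cong k<m (Mcols d (heights w)) (Mcols d ns) z′ z columns Az′≡Az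
  where
  w = keepLast k (descents ns)
  columns = Mcols-agreeOnLast⁺ d (heights w) ns (heights-keepLast-descents k ns adm)
  z′ = proj₁ (Mcols-sameImage d ns (heights w) z)
  Az′≡Az = proj₂ (Mcols-sameImage d ns (heights w) z)
  p∈ = ∈-cartesianProduct⁺ (∈-lexPrefix⁺ (<⇒≤ k<m) w (keepLast-supportedOnLast k (descents ns))) (lexWords-complete z′)

proposition13 : (d k : ℕ) → 1 ≤ k → k ≤ 2 ^ d →
    Σ (List (List Bool)) λ L →
      Unique L × ((w : List Bool) → (w ∈ L) ⇔ IsAffineNecklace d k w)
        × length L ≡ 2 ^ (k + 2 ^ d ∸ 1)
proposition13 d (suc k) _ k<m =
  map (necklaceOf d k) (necklaceParameters d k) ,
  unique-map⁺-injectiveOn (necklaceOf-injective d k<m) (necklaceParameters-unique d k) ,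
  (λ w → mk⇔ (to w) (from w)) ,
  trans (Listₚ.length-map _ (necklaceParameters d k)) (length-necklaceParameters d (<⇒≤ k<m))
  where
  to : ∀ w → w ∈ map (necklaceOf d k) (necklaceParameters d k) → IsAffineNecklace d (suc k) w
  to w w∈ with (v , z) , _ , refl ← ∈-map⁻ (necklaceOf d k) w∈ = heights v , heights-admissible v , z , refl
  from : ∀ w → IsAffineNecklace d (suc k) w → w ∈ map (necklaceOf d k) (necklaceParameters d k)
  from w (ns , adm , z , refl) with p , p∈ , eq ← necklaceOf-surjective d k<m ns adm z =
    subst (_∈ _) eq (∈-map⁺ (necklaceOf d k) p∈)
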